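{- For every closed $\mathrm{BCCSP}_{\|}$ term $p$ there exists a closed BCCSP term $q$ (i.e. one with no occurrence of $\|$) such that $\mathcal{E}_{\mathtt{RS}}\vdash p\approx q$, where $\mathcal{E}_{\mathtt{RS}} = \mathcal{E}_1 \cup \{\mathrm{RS}, \mathrm{RSP1}, \mathrm{RSP2}, \mathrm{EL2}\}$.
   Context: Let $\mathcal{A}$ be a finite non-empty set of actions and $\mathcal{V}$ a countably infinite set of variables. $\mathrm{BCCSP}_{\|}$ terms: $t ::= \mathbf{0} \mid x \mid a.t \mid t+t \mid t \,\|\, t$ ($a\in\mathcal{A}$, $x \in \mathcal{V}$; $ax$ means $a.x$); BCCSP terms are those without $\|$; closed terms contain no variables. $\mathcal{E}\vdash t\approx u$: derivable in equational logic (reflexivity, symmetry, transitivity, substitution instances of axioms, closure under $a.\_$, $+$, $\|$). Axioms with concrete action names stand for all instances with actions from $\mathcal{A}$. $\mathcal{E}_1$: A0 $x+\mathbf{0}\approx x$; A1 $x+y\approx y+x$; A2 $(x+y)+z \approx x+(y+z)$; A3 $x+x\approx x$; P0 $x\|\mathbf{0}\approx x$; P1 $x\|y \approx y \| x$. RS: $a(bx+by+z)\approx a(bx+by+z)+a(bx+z)$. RSP1: $(ax+ay+u)\|(bz+bw+v) \approx (ax+u)\|(bz+bw+v) + (ay+u)\|(bz+bw+v) + (ax+ay+u)\|(bz+v) + (ax+ay+u)\|(bw+v)$. RSP2: $(\sum_{i\in I} a_i x_i)\|(by+bz+w) \approx (\sum_{i\in I} a_ix_i)\|(by+w) + (\sum_{i\in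 I} a_ix_i)\|(bz+w) + \sum_{i\in I} a_i(x_i \| (by+bz+w))$, $I$ finite, $a_j\neq a_k$ for $j\neq k$. EL2: $\sum_{i\in I} a_ix_i \| \sum_{j\in J} b_jy_j \approx \sum_{i\in I} a_i(x_i \| \sum_{j\in J} b_j y_j) + \sum_{j\in J} b_j(\sum_{i\in I} a_i x_i \| y_j)$, $I,J$ finite, the $a_i$ pairwise distinct, the $b_j$ pairwise distinct. ($\sum$ over an empty set is $\mathbf{0}$.) -}

module Defs where

open import Data.Nat using (ℕ; suc)
open import Data.Fin using (Fin)
open import Data.List using (List; []; _∷_; map; foldr)
open import Data.List.Relation.Unary.AllPairs using (AllPairs)
open import Data.Product using (_×_; _,_; proj₁; proj₂)
open import Relation.Binary.PropositionalEquality using (_≢_)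

-- The finite non-empty action set 𝒜 is modelled as Fin (suc k) for an
-- arbitrary k; the countably infinite set of variables 𝒱 is ℕ.
module Syntax (k : ℕ) where

  Act : Set
  Act = Fin (suc k)

  Var : Set
  Var = ℕ

  infixr 7 _·_
  infixl 5 _⊕_
  infixl 6 _∥_

  data Term : Set where
    𝟎   : Term
    var : Var → Term
    _·_ : Act → Term → Term
    _⊕_ : Term → Term → Term
    _∥_ : Term → Term → Term

  data Closed : Term → Set where
    𝟎   : Closed 𝟎
    _·_ : ∀ a {t} → Closed t → Closed (a · t)
    _⊕_ : ∀ {t u} → Closed t → Closed u → Closed (t ⊕ u)
    _∥_ : ∀ {t u} → Closed t → Closed u → Closed (t ∥ u)

  data BCCSP : Term → Set where
    𝟎   : BCCSP 𝟎
    var : ∀ x → BCCSP (var x)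
    _·_ : ∀ a {t} → BCCSP t → BCCSP (a · t)
    _⊕_ : ∀ {t u} → BCCSP t → BCCSP u → BCCSP (t ⊕ u)

  -- finite sums  Σ_{i∈I} a_i t_i  (empty sum is 𝟎), given as a list of
  -- summands (a_i , t_i); the summation is a right-nested sum ending in 𝟎.
  Σ : List (Act × Term) → Term
  Σ = foldr (λ at s → (proj₁ at · proj₂ at) ⊕ s) 𝟎

  DistinctActs : List (Act × Term) → Set
  DistinctActs l = AllPairs _≢_ (map proj₁ l)

  mapT : (Term → Term) → List (Act × Term) → List (Act × Term)
  mapT f = map (λ at → proj₁ at , f (proj₂ at))

  -- Axioms of E_RS = E1 ∪ {RS, RSP1, RSP2, EL2}.  The metavariables range
  -- over all terms, so every substitution instance is itself an axiom
  -- instance.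
  data AxRS : Term → Term → Set where
    A0 : ∀ x → AxRS (x ⊕ 𝟎) x
    A1 : ∀ x y → AxRS (x ⊕ y) (y ⊕ x)
    A2 : ∀ x y z → AxRS ((x ⊕ y) ⊕ z) (x ⊕ (y ⊕ z))
    A3 : ∀ x → AxRS (x ⊕ x) x
    P0 : ∀ x → AxRS (x ∥ 𝟎) x
    P1 : ∀ x y → AxRS (x ∥ y) (y ∥ x)
    RS : ∀ (a b : Act) x y z →
         AxRS (a · (b · x ⊕ b · y ⊕ z))
              (a · (b · x ⊕ b · y ⊕ z) ⊕ a · (b · x ⊕ z))
    RSP1 : ∀ (a b : Act) x y u z w v →
         AxRS ((a · x ⊕ a · y ⊕ u) ∥ (b · z ⊕ b · w ⊕ v))
              ((a · x ⊕ u) ∥ (b · z ⊕ b · w ⊕ v)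
                ⊕ (a · y ⊕ u) ∥ (b · z ⊕ b · w ⊕ v)
                ⊕ (a · x ⊕ a · y ⊕ u) ∥ (b · z ⊕ v)
                ⊕ (a · x ⊕ a · y ⊕ u) ∥ (b · w ⊕ v))
    RSP2 : ∀ (l : List (Act × Term)) → DistinctActs l →
         ∀ (b : Act) y z w →
         AxRS (Σ l ∥ (b · y ⊕ b · z ⊕ w))
              (Σ l ∥ (b · y ⊕ w) ⊕ Σ l ∥ (b · z ⊕ w)
                ⊕ Σ (mapT (λ x → x ∥ (b · y ⊕ b · z ⊕ w)) l))
    EL2 : ∀ (l r : List (Act × Term)) → DistinctActs l → DistinctActs r →
         AxRS (Σ l ∥ Σ r)
              (Σ (mapT (λ x → x ∥ Σ r) l) ⊕ Σ (mapT (λ y → Σ l ∥ y) r))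

  infix 4 _⊢_≈_
  data _⊢_≈_ (E : Term → Term → Set) : Term → Term → Set where
    ax    : ∀ {t u} → E t u → E ⊢ t ≈ u
    refl  : ∀ {t} → E ⊢ t ≈ t
    sym   : ∀ {t u} → E ⊢ t ≈ u → E ⊢ u ≈ t
    trans : ∀ {t u v} → E ⊢ t ≈ u → E ⊢ u ≈ v → E ⊢ t ≈ v
    pre   : ∀ a {t u} → E ⊢ t ≈ u → E ⊢ a · t ≈ a · u
    plus  : ∀ {t t′ u u′} → E ⊢ t ≈ t′ → E ⊢ u ≈ u′ → E ⊢ t ⊕ u ≈ t′ ⊕ u′
    par   : ∀ {t t′ u u′} → E ⊢ t ≈ t′ → E ⊢ u ≈ u′ → E ⊢ t ∥ u ≈ t′ ∥ u′

{-# OPTIONS --safe #-}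
module Submission where

open import Defs
open import Data.Nat using (ℕ; suc; _+_; _≤_; _<_; s≤s)
open import Data.Nat.Properties
  using (m≤m+n; m≤n+m; n<1+n; +-comm; <-trans; <-≤-trans; +-monoˡ-<; +-monoʳ-<)
open import Data.Nat.Tactic.RingSolver using (solve-∀)
open import Data.Product using (Σ-syntax; _×_; _,_; proj₁; proj₂)
open import Data.Sum using (_⊎_; inj₁; inj₂)
open import Data.List using (List; []; _∷_; map; _++_)
open import Data.List.Relation.Unary.All using (All; []; _∷_)
open import Data.List.Relation.Unary.Any using (here; there)
open import Data.List.Relation.Unary.AllPairs using ([]; _∷_)
open import Data.List.Membership.Propositional using (_∈_)
open import Data.List.Relation.Binary.Permutation.Propositional
  using (_↭_; refl; prep; swap; trans; ↭-sym)
open import Data.List.Relation.Binary.Permutation.Propositional.Properties using (shift)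
open import Data.Fin using (_≟_)
open import Relation.Nullary using (yes; no)
open import Relation.Binary.PropositionalEquality as ≡ using (_≡_; _≢_; cong; subst)

-- Every closed term is provably equal to a sum of prefixes, a "tree" of
-- nested sums.  Sums and prefixes of such normal forms are again normal
-- forms, so it suffices to normalise a merge f ∥ g of two of them, by
-- induction on the total number of prefixes.  If f (or g) has two summands
-- with the same action, RSP1 (both sides) or RSP2 (one side) rewrites f ∥ g
-- into a sum of merges in each of which one of these summands is dropped.
-- Otherwise both sides have pairwise distinct actions and EL2 expands f ∥ g
-- into prefixed merges of a side with a subtree of the other.

x+[1+y+z]≡y+[1+x+z] : ∀ x y z → x + suc (y + z) ≡ y + suc (x + z)
x+[1+y+z]≡y+[1+x+z] = solve-∀

<-+ʳ-≤ : ∀ {m′ m n o} → m′ < m → m + n ≤ o → m′ + n < o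
<-+ʳ-≤ {n = n} m′<m m+n≤o = <-≤-trans (+-monoˡ-< n m′<m) m+n≤o

<-+ˡ-≤ : ∀ {m n′ n o} → n′ < n → m + n ≤ o → m + n′ < o
<-+ˡ-≤ {m} n′<n m+n≤o = <-≤-trans (+-monoʳ-< m n′<n) m+n≤o

module NormalForms (k : ℕ) where
  open Syntax k

  infix 4 _≈_

  _≈_ : Term → Term → Set
  t ≈ u = AxRS ⊢ t ≈ u

  ⊕-swapˡ : ∀ x y z → x ⊕ (y ⊕ z) ≈ y ⊕ (x ⊕ z)
  ⊕-swapˡ x y z = trans (sym (ax (A2 x y z))) (trans (plus (ax (A1 x y)) refl) (ax (A2 y x z)))

  data Tree : Set where
    node : List (Act × Tree) → Tree

  Forest : Set
  Forest = List (Act × Tree)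

  mutual
    ⟦_⟧ᵗ : Tree → Term
    ⟦ node f ⟧ᵗ = Σ (summands f)

    summands : Forest → List (Act × Term)
    summands [] = []
    summands ((a , t) ∷ f) = (a , ⟦ t ⟧ᵗ) ∷ summands f

  ⟦_⟧ : Forest → Term
  ⟦ f ⟧ = Σ (summands f)

  mutual
    closed : ∀ f → Closed ⟦ f ⟧
    closed [] = 𝟎
    closed ((a , node g) ∷ f) = (a · closed g) ⊕ closed f

    bccsp : ∀ f → BCCSP ⟦ f ⟧
    bccsp [] = 𝟎
    bccsp ((a , node g) ∷ f) = (a · bccsp g) ⊕ bccsp f

  ⟦++⟧ : ∀ f g → ⟦ f ++ g ⟧ ≈ ⟦ f ⟧ ⊕ ⟦ g ⟧
  ⟦++⟧ [] g = trans (sym (ax (A0 ⟦ g ⟧))) (ax (A1 ⟦ g ⟧ 𝟎))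
  ⟦++⟧ ((a , t) ∷ f) g = trans (plus refl (⟦++⟧ f g)) (sym (ax (A2 _ _ _)))

  ⟦⟧-↭ : ∀ {f g} → f ↭ g → ⟦ f ⟧ ≈ ⟦ g ⟧
  ⟦⟧-↭ refl = refl
  ⟦⟧-↭ (prep _ p) = plus refl (⟦⟧-↭ p)
  ⟦⟧-↭ (swap _ _ p) = trans (⊕-swapˡ _ _ _) (plus refl (plus refl (⟦⟧-↭ p)))
  ⟦⟧-↭ (trans p q) = trans (⟦⟧-↭ p) (⟦⟧-↭ q)

  mutual
    sizeᵗ : Tree → ℕ
    sizeᵗ (node f) = size f

    size : Forest → ℕ
    size [] = 0
    size ((a , t) ∷ f) = suc (sizeᵗ t + size f)

  size-↭ : ∀ {f g} → f ↭ g → size f ≡ size g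
  size-↭ refl = ≡.refl
  size-↭ (prep (a , t) p) = cong (λ n → suc (sizeᵗ t + n)) (size-↭ p)
  size-↭ {_ ∷ _ ∷ f} (swap (_ , s) (_ , t) p) =
    cong suc (≡.trans (x+[1+y+z]≡y+[1+x+z] (sizeᵗ s) (sizeᵗ t) (size f))
                      (cong (λ n → sizeᵗ t + suc (sizeᵗ s + n)) (size-↭ p)))
  size-↭ (trans p q) = ≡.trans (size-↭ p) (size-↭ q)

  size-tail : ∀ e f → size f < size (e ∷ f)
  size-tail (_ , t) f = s≤s (m≤n+m (size f) (sizeᵗ t))

  size-∷-< : ∀ e {f g} → size f < size g → size (e ∷ f) < size (e ∷ g)
  size-∷-< (_ , t) f<g = s≤s (+-monoʳ-< (sizeᵗ t) f<g)

  ∈⇒sizeᵗ< : ∀ {e f} → e ∈ f → sizeᵗ (proj₂ e) < size f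
  ∈⇒sizeᵗ< {_ , t} {_ ∷ f} (here ≡.refl) = s≤s (m≤m+n (sizeᵗ t) (size f))
  ∈⇒sizeᵗ< {f = e ∷ f} (there e∈f) = <-trans (∈⇒sizeᵗ< e∈f) (size-tail e f)

  Distinct : Forest → Set
  Distinct f = DistinctActs (summands f)

  record Duplicate (f : Forest) : Set where
    field
      a : Act
      x y : Tree
      rest : Forest
      perm : f ↭ (a , x) ∷ (a , y) ∷ rest

    expanded : Term
    expanded = (a · ⟦ x ⟧ᵗ ⊕ a · ⟦ y ⟧ᵗ) ⊕ ⟦ rest ⟧

    split : ⟦ f ⟧ ≈ expanded
    split = trans (⟦⟧-↭ perm) (sym (ax (A2 _ _ _)))

    keep-x keep-y : Forest
    keep-x = (a , x) ∷ rest
    keep-y = (a , y) ∷ rest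

    size-keep-x : size keep-x < size f
    size-keep-x = subst (size keep-x <_) (≡.sym (size-↭ perm))
                    (size-∷-< (a , x) {g = keep-y} (size-tail (a , y) rest))

    size-keep-y : size keep-y < size f
    size-keep-y = subst (size keep-y <_) (≡.sym (size-↭ perm)) (size-tail (a , x) keep-y)

  find : ∀ a f → (Σ[ y ∈ Tree ] Σ[ rest ∈ Forest ] (f ↭ (a , y) ∷ rest))
                 ⊎ All (a ≢_) (map proj₁ (summands f))
  find a [] = inj₂ []
  find a ((b , t) ∷ f) with a ≟ b | find a f
  ... | yes ≡.refl | _ = inj₁ (t , f , refl)
  ... | no a≢b | inj₁ (y , rest , p) = inj₁ (y , (b , t) ∷ rest , trans (prep _ p) (swap _ _ refl))
  ... | no a≢b | inj₂ a∉f = inj₂ (a≢b ∷ a∉f)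

  duplicate? : ∀ f → Duplicate f ⊎ Distinct f
  duplicate? [] = inj₂ []
  duplicate? ((a , x) ∷ f) with find a f | duplicate? f
  ... | inj₁ (y , rest , p) | _ = inj₁ (record { perm = prep _ p })
  ... | inj₂ a∉f | inj₂ dist = inj₂ (a∉f ∷ dist)
  ... | inj₂ _ | inj₁ d = inj₁ (record
    { rest = (a , x) ∷ rest
    ; perm = trans (prep _ perm) (↭-sym (shift (a , x) ((b , x′) ∷ (b , y′) ∷ []) rest))
    })
    where open Duplicate d renaming (a to b; x to x′; y to y′)

  HasNF : Term → Set
  HasNF t = Σ[ f ∈ Forest ] (t ≈ ⟦ f ⟧)

  HasNF-cong : ∀ {t u} → t ≈ u → HasNF u → HasNF t
  HasNF-cong t≈u (f , u≈f) = f , trans t≈u u≈f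

  HasNF-⊕ : ∀ {t u} → HasNF t → HasNF u → HasNF (t ⊕ u)
  HasNF-⊕ (f , t≈f) (g , u≈g) = f ++ g , trans (plus t≈f u≈g) (sym (⟦++⟧ f g))

  HasNF-Σ : ∀ (φ : Term → Term) f → (∀ {e} → e ∈ f → HasNF (φ ⟦ proj₂ e ⟧ᵗ)) →
            HasNF (Σ (mapT φ (summands f)))
  HasNF-Σ φ [] _ = [] , refl
  HasNF-Σ φ ((a , t) ∷ f) hyp =
    let g , φt≈g = hyp (here ≡.refl)
        h , rest≈h = HasNF-Σ φ f (λ e∈f → hyp (there e∈f))
    in (a , node g) ∷ h , plus (pre a φt≈g) rest≈h

  Merge< : ℕ → Set
  Merge< n = ∀ f g → size f + size g < n → HasNF (⟦ f ⟧ ∥ ⟦ g ⟧)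

  merge-duplicate-duplicate : ∀ {n f g} → Merge< n → Duplicate f → Duplicate g →
                              size f + size g ≤ n → HasNF (⟦ f ⟧ ∥ ⟦ g ⟧)
  merge-duplicate-duplicate {f = f} {g} ih d e bound =
    HasNF-cong (trans (par D.split E.split) (ax (RSP1 _ _ _ _ _ _ _ _)))
      (HasNF-⊕ (HasNF-⊕ (HasNF-⊕ keep-xˡ keep-yˡ) keep-xʳ) keep-yʳ)
    where
      module D = Duplicate d
      module E = Duplicate e

      keep-xˡ : HasNF (⟦ D.keep-x ⟧ ∥ E.expanded)
      keep-xˡ = HasNF-cong (par refl (sym E.split)) (ih D.keep-x g (<-+ʳ-≤ D.size-keep-x bound))

      keep-yˡ : HasNF (⟦ D.keep-y ⟧ ∥ E.expanded)
      keep-yˡ = HasNF-cong (par refl (sym E.split)) (ih D.keep-y g (<-+ʳ-≤ D.size-keep-y bound))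

      keep-xʳ : HasNF (D.expanded ∥ ⟦ E.keep-x ⟧)
      keep-xʳ = HasNF-cong (par (sym D.split) refl) (ih f E.keep-x (<-+ˡ-≤ E.size-keep-x bound))

      keep-yʳ : HasNF (D.expanded ∥ ⟦ E.keep-y ⟧)
      keep-yʳ = HasNF-cong (par (sym D.split) refl) (ih f E.keep-y (<-+ˡ-≤ E.size-keep-y bound))

  merge-distinct-duplicate : ∀ {n f g} → Merge< n → Distinct f → Duplicate g →
                             size f + size g ≤ n → HasNF (⟦ f ⟧ ∥ ⟦ g ⟧)
  merge-distinct-duplicate {f = f} {g} ih dist e bound =
    HasNF-cong (trans (par refl E.split) (ax (RSP2 (summands f) dist E.a _ _ _)))
      (HasNF-⊕ (HasNF-⊕ keep-x keep-y) expand)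
    where
      module E = Duplicate e

      keep-x : HasNF (⟦ f ⟧ ∥ ⟦ E.keep-x ⟧)
      keep-x = ih f E.keep-x (<-+ˡ-≤ E.size-keep-x bound)

      keep-y : HasNF (⟦ f ⟧ ∥ ⟦ E.keep-y ⟧)
      keep-y = ih f E.keep-y (<-+ˡ-≤ E.size-keep-y bound)

      expand : HasNF (Σ (mapT (_∥ E.expanded) (summands f)))
      expand = HasNF-Σ (_∥ E.expanded) f λ { {_ , node h} h∈f →
                 HasNF-cong (par refl (sym E.split)) (ih h g (<-+ʳ-≤ (∈⇒sizeᵗ< h∈f) bound)) }

  merge-distinct-distinct : ∀ {n f g} → Merge< n → Distinct f → Distinct g →
                            size f + size g ≤ n → HasNF (⟦ f ⟧ ∥ ⟦ g ⟧)
  merge-distinct-distinct {f = f} {g} ih dist-f dist-g bound =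
    HasNF-cong (ax (EL2 (summands f) (summands g) dist-f dist-g))
      (HasNF-⊕ (HasNF-Σ (_∥ ⟦ g ⟧) f λ { {_ , node h} h∈f →
                  ih h g (<-+ʳ-≤ (∈⇒sizeᵗ< h∈f) bound) })
               (HasNF-Σ (⟦ f ⟧ ∥_) g λ { {_ , node h} h∈g →
                  ih f h (<-+ˡ-≤ (∈⇒sizeᵗ< h∈g) bound) }))

  merge : ∀ n → Merge< n
  merge (suc n) f g (s≤s bound) with duplicate? f | duplicate? g
  ... | inj₁ d | inj₁ e = merge-duplicate-duplicate (merge n) d e bound
  ... | inj₁ d | inj₂ dist = HasNF-cong (ax (P1 _ _))
          (merge-distinct-duplicate (merge n) dist d (subst (_≤ n) (+-comm (size f) (size g)) bound))
  ... | inj₂ dist | inj₁ e = merge-distinct-duplicate (merge n) dist e bound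
  ... | inj₂ dist-f | inj₂ dist-g = merge-distinct-distinct (merge n) dist-f dist-g bound

  closed⇒HasNF : ∀ {t} → Closed t → HasNF t
  closed⇒HasNF 𝟎 = [] , refl
  closed⇒HasNF (a · c) =
    let f , t≈f = closed⇒HasNF c
    in (a , node f) ∷ [] , trans (pre a t≈f) (sym (ax (A0 _)))
  closed⇒HasNF (c ⊕ d) = HasNF-⊕ (closed⇒HasNF c) (closed⇒HasNF d)
  closed⇒HasNF (c ∥ d) =
    let f , t≈f = closed⇒HasNF c
        g , u≈g = closed⇒HasNF d
    in HasNF-cong (par t≈f u≈g) (merge _ f g (n<1+n (size f + size g)))

proposition3p5 : (k : ℕ) → let open Syntax k in
    (p : Term) → Closed p →
      Σ[ q ∈ Term ] (Closed q × BCCSP q × AxRS ⊢ p ≈ q)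
proposition3p5 k p c =
  let open NormalForms k
      f , p≈f = closed⇒HasNF c
  in ⟦ f ⟧ , closed f , bccsp f , p≈f
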